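{- Let $\Omega$ be a stable succession rule (as defined in the context) with axiom $a$. Then for every $n\ge 1$ the list $\mathcal{L}_n$ (defined in the context) is well defined and any two consecutive elements of $\mathcal{L}_n$ differ in exactly one position (Hamming distance one).
   Context: A succession rule $\Omega$ consists of an axiom label $(a)$ and, for each label $(k)$, a production $(k)\rightsquigarrow(e_1(k))(e_2(k))\cdots(e_k(k))$, an ordered list of $k$ labels. Entries of a production that have the same numerical value but occupy different positions are regarded as distinct symbols (distinguished by indices, e.g. $(k+1)_1,(k+1)_2$), each symbol having the production of its value. $\Omega$ is stable if there are two symbols $c_1,c_2$ (with values $c_1\le c_2$) such that for each label $k$ there exist indices $i<j$ with $e_i(k)=c_1$ and $e_j(k)=c_2$. For such $k$ define the generalized shifted productions (lists, empty index ranges omitted): $s(k,c_1)=\langle c_1,e_{i-1}(k),\dots,e_1(k),e_k(k),\dots,e_{j+1}(k),e_{j-1}(k),\dots,e_{i+1}(k),c_2\rangle$ and $s(k,c_2)=\langle c_2,e_{j+1}(k),\dots,e_k(k),e_1(k),\dots,e_{i-1}(k),e_{i+1}(k),\dots,e_{j-1}(k),c_1\rangle$. A word of length $n$ is a sequence of symbols $w_1\cdots w_n$ with $w_1=a$ and $w_{m+1}$ an entry of the production of $w_m$ (a root-to-node path in the generating tree). For a list $L$, $\mathrm{last}(L)$ is its last element; $\overrightarrow{x}$ is the rightmost symbol of a word $x$; $x\circ L$ is the list obtained by appending each element of $L$ (in order) to $x$; $\Theta$ is concatenation of lists. Define $\mathcal{L}_1=\langle a\rangle$ and, for $n>1$,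 with $l^{n-1}_i$ the $i$-th element of $\mathcal{L}_{n-1}$ and $M=|\mathcal{L}_{n-1}|$, $\mathcal{L}_n=\Theta_{i=1}^M L^i_n$, where $L^1_n=l^{n-1}_1\circ s\big(\overrightarrow{l^{n-1}_1},c_1\big)$ and, for $i>1$, $L^i_n=l^{n-1}_i\circ s\big(\overrightarrow{l^{n-1}_i},\overrightarrow{\mathrm{last}(L^{i-1}_n)}\big)$. -}

module Defs where

open import Data.Nat using (ℕ; zero; suc; _≤_; _+_)
import Data.Nat as ℕ
open import Data.Bool using (Bool; true; false; if_then_else_)
open import Data.Product using (_×_; _,_; proj₁; proj₂; ∃-syntax)
open import Data.List using (List; []; _∷_; _++_; reverse; map; length; [_])
open import Data.List.Membership.Propositional using (_∈_)
open import Data.Vec using (Vec; toList)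
open import Data.Maybe using (Maybe; just; nothing; _>>=_)
open import Data.Unit using (⊤)
open import Relation.Binary.PropositionalEquality using (_≡_)
open import Relation.Nullary using (yes; no)
open import Relation.Nullary.Decidable using (⌊_⌋)

record Rule : Set where
  field
    axiom : ℕ
    prod  : (k : ℕ) → Vec ℕ k
open Rule public

-- A symbol: (value , occurrence index).  Entries with equal value in a
-- production are distinguished by the number of equal-valued entries
-- preceding them (0-based), i.e. (k+1)_1 ↦ (k+1 , 0), (k+1)_2 ↦ (k+1 , 1).
Sym : Set
Sym = ℕ × ℕ

value : Sym → ℕ
value = proj₁

_==S_ : Sym → Sym → Bool
(a , b) ==S (c , d) = ⌊ a ℕ.≟ c ⌋ Data.Bool.∧ ⌊ b ℕ.≟ d ⌋
  where import Data.Bool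

count : ℕ → List ℕ → ℕ
count v [] = 0
count v (x ∷ xs) = (if ⌊ v ℕ.≟ x ⌋ then 1 else 0) + count v xs

annotate : List ℕ → List ℕ → List Sym
annotate pre [] = []
annotate pre (x ∷ xs) = (x , count x pre) ∷ annotate (x ∷ pre) xs

syms : Rule → ℕ → List Sym
syms Ω k = annotate [] (toList (prod Ω k))

axiomSym : Rule → Sym
axiomSym Ω = (axiom Ω , 0)

data Reachable (Ω : Rule) : ℕ → Set where
  ax   : Reachable Ω (axiom Ω)
  step : ∀ {k x} → Reachable Ω k → x ∈ toList (prod Ω k) → Reachable Ω x

Stable : Rule → Sym → Sym → Set
Stable Ω c₁ c₂ = value c₁ ≤ value c₂ ×
  (∀ k → Reachable Ω k →
     ∃[ A ] ∃[ B ] ∃[ C ] (syms Ω k ≡ A ++ c₁ ∷ B ++ c₂ ∷ C))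

splitOn : Sym → List Sym → Maybe (List Sym × List Sym)
splitOn c [] = nothing
splitOn c (x ∷ xs) with x ==S c
... | true  = just ([] , xs)
... | false = splitOn c xs >>= λ { (A , R) → just (x ∷ A , R) }

shift : Rule → Sym → Sym → ℕ → Sym → Maybe (List Sym)
shift Ω c₁ c₂ k x =
  splitOn c₁ (syms Ω k) >>= λ { (A , R) →
  splitOn c₂ R >>= λ { (B , C) →
  if x ==S c₁
    then just (c₁ ∷ reverse A ++ reverse C ++ reverse B ++ [ c₂ ])
    else (if x ==S c₂
      then just (c₂ ∷ C ++ A ++ B ++ [ c₁ ])
      else nothing) } }

Word : Set
Word = List Sym

lastM : ∀ {A : Set} → List A → Maybe A
lastM [] = nothing
lastM (x ∷ []) = just x
lastM (x ∷ y ∷ ys) = lastM (y ∷ ys)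

_∘ʷ_ : Word → List Sym → List Word
x ∘ʷ L = map (λ y → x ++ [ y ]) L

-- builds Θ_i L^i_n from 𝓛_{n-1}; p is the rightmost symbol of last(L^{i-1}_n)
-- (initially c₁)
nextGo : Rule → Sym → Sym → Sym → List Word → Maybe (List Word)
nextGo Ω c₁ c₂ p [] = just []
nextGo Ω c₁ c₂ p (l ∷ ls) =
  lastM l >>= λ r →
  shift Ω c₁ c₂ (value r) p >>= λ t →
  lastM t >>= λ q →
  nextGo Ω c₁ c₂ q ls >>= λ rest →
  just ((l ∘ʷ t) ++ rest)

𝓛 : Rule → Sym → Sym → ℕ → Maybe (List Word)
𝓛 Ω c₁ c₂ zero = nothing
𝓛 Ω c₁ c₂ (suc zero) = just [ [ axiomSym Ω ] ]
𝓛 Ω c₁ c₂ (suc (suc n)) = 𝓛 Ω c₁ c₂ (suc n) >>= nextGo Ω c₁ c₂ c₁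

hamming : Word → Word → ℕ
hamming [] [] = 0
hamming (x ∷ xs) (y ∷ ys) = (if x ==S y then 0 else 1) + hamming xs ys
hamming [] (_ ∷ _) = 0
hamming (_ ∷ _) [] = 0

HammingOne : Word → Word → Set
HammingOne x y = length x ≡ length y × hamming x y ≡ 1

ConsecutiveHammingOne : List Word → Set
ConsecutiveHammingOne [] = ⊤
ConsecutiveHammingOne (x ∷ []) = ⊤
ConsecutiveHammingOne (x ∷ y ∷ ys) = HammingOne x y × ConsecutiveHammingOne (y ∷ ys)

-- The entries of a production are pairwise distinct: an entry's occurrence index exceeds
-- the number of equal values before it, which is the index of every earlier entry of that
-- value. Both shifted productions are rearrangements of the production, so consecutive
-- entries of s(k, p) are distinct; moreover s(k, p) starts with the pivot p and ends with
-- the other pivot. Hence inside a block l ∘ s(k, p) consecutive words differ only in their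
-- last letter, while the last word l·q of one block and the first word l′·q of the next
-- differ exactly where l and l′ do, in one position by induction on n. Stability is only
-- assumed for labels of the generating tree, so the induction also records that every word
-- ends in a reachable label; the inequality value c₁ ≤ value c₂ is never used.
module Submission where

open import Defs
open import Data.Nat using (ℕ; _≤_; zero; suc; _+_)
import Data.Nat as ℕ
open import Data.Nat.Properties using (m≤n+m; ≤-refl; ≤-trans; 1+n≰n; suc-injective; +-assoc)
open import Data.Bool using (true; false; if_then_else_)
open import Data.Product using (_×_; ∃-syntax; _,_; proj₂)
open import Data.Sum using (_⊎_; inj₁; inj₂)
open import Data.Maybe using (just; _>>=_)
import Data.Maybe as Maybe
open import Data.List using (List; []; _∷_; _++_; [_]; _∷ʳ_; reverse; map; length; head; last)
open import Data.List.Properties using (length-++; last-map)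
open import Data.List.Membership.Propositional using (_∉_)
open import Data.List.Membership.Propositional.Properties using (∈-++⁺ˡ; ∈-++⁺ʳ)
open import Data.List.Relation.Unary.Any using (here; there)
open import Data.List.Relation.Unary.All as All using (All; []; _∷_)
import Data.List.Relation.Unary.All.Properties as All
open import Data.List.Relation.Unary.AllPairs using ([]; _∷_)
open import Data.List.Relation.Unary.Unique.Propositional using (Unique)
open import Data.List.Relation.Unary.Unique.Propositional.Properties using (Unique[x∷xs]⇒x∉xs)
open import Data.List.Relation.Unary.Linked as Linked using (Linked; []; [-]; _∷_)
import Data.List.Relation.Unary.Linked.Properties as Linked
open import Data.List.Relation.Binary.Permutation.Propositional
  using (_↭_; prep; swap; ↭-sym; ↭-trans; ↭⇒↭ₛ; module PermutationReasoning)
open import Data.List.Relation.Binary.Permutation.Propositional.Properties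
  using (All-resp-↭; ++⁺; ++⁺ˡ; ++-comm; ++-assoc; ∷↭∷ʳ; ↭-reverse) renaming (shift to ↭-shift)
import Data.List.Relation.Binary.Permutation.Setoid.Properties as Permutationₛ
open import Data.Maybe.Relation.Binary.Connected using (Connected; just; just-nothing)
open import Data.Vec using (toList)
open import Function using (_∘_)
open import Relation.Binary.PropositionalEquality
  using (_≡_; _≢_; refl; sym; trans; cong; cong₂; subst; subst₂; setoid)
open import Relation.Nullary using (yes; no; contradiction)

==S-refl : ∀ s → s ==S s ≡ true
==S-refl (a , b) with a ℕ.≟ a | b ℕ.≟ b
... | yes _ | yes _   = refl
... | no a≢a | _      = contradiction refl a≢a
... | yes _ | no b≢b  = contradiction refl b≢b

==S-≢ : ∀ {s t} → s ≢ t → s ==S t ≡ false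
==S-≢ {a , b} {c , d} s≢t with a ℕ.≟ c | b ℕ.≟ d
... | yes refl | yes refl = contradiction refl s≢t
... | yes _    | no _     = refl
... | no _     | _        = refl

splitOn-++ : ∀ {c} A R → c ∉ A → splitOn c (A ++ c ∷ R) ≡ just (A , R)
splitOn-++ {c} [] R _ rewrite ==S-refl c = refl
splitOn-++ {c} (x ∷ A) R c∉x∷A
  rewrite ==S-≢ (λ x≡c → c∉x∷A (here (sym x≡c))) | splitOn-++ A R (c∉x∷A ∘ there) = refl

lastM-++ : ∀ {X : Set} (xs : List X) {ys y} → lastM ys ≡ just y → lastM (xs ++ ys) ≡ just y
lastM-++ []            eq = eq
lastM-++ (x ∷ [])      {_ ∷ _} eq = eq
lastM-++ (x ∷ x′ ∷ xs) eq = lastM-++ (x′ ∷ xs) eq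

lastM≗last : ∀ {X : Set} (xs : List X) → lastM xs ≡ last xs
lastM≗last []            = refl
lastM≗last (x ∷ [])      = refl
lastM≗last (x ∷ x′ ∷ xs) = lastM≗last (x′ ∷ xs)

count-self : ∀ x pre → count x (x ∷ pre) ≡ suc (count x pre)
count-self x pre with x ℕ.≟ x
... | yes _  = refl
... | no x≢x = contradiction refl x≢x

annotate-counts : ∀ pre xs → All (λ s → count (value s) pre ≤ proj₂ s) (annotate pre xs)
annotate-counts pre []       = []
annotate-counts pre (x ∷ xs) =
  ≤-refl ∷ All.map (≤-trans (m≤n+m _ _)) (annotate-counts (x ∷ pre) xs)

annotate-unique : ∀ pre xs → Unique (annotate pre xs)
annotate-unique pre []       = []
annotate-unique pre (x ∷ xs) =
  All.map fresh (annotate-counts (x ∷ pre) xs) ∷ annotate-unique (x ∷ pre) xs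
  where
  fresh : ∀ {s} → count (value s) (x ∷ pre) ≤ proj₂ s → (x , count x pre) ≢ s
  fresh later refl = 1+n≰n (subst (_≤ count x pre) (count-self x pre) later)

All-annotate : ∀ {P : ℕ → Set} pre xs → All P xs → All (P ∘ value) (annotate pre xs)
All-annotate pre []       []         = []
All-annotate pre (x ∷ xs) (px ∷ pxs) = px ∷ All-annotate (x ∷ pre) xs pxs

hamming-++ : ∀ l l′ xs ys → length l ≡ length l′ →
  hamming (l ++ xs) (l′ ++ ys) ≡ hamming l l′ + hamming xs ys
hamming-++ []      []       xs ys _  = refl
hamming-++ (x ∷ l) (x′ ∷ l′) xs ys eq =
  trans (cong (mismatch +_) (hamming-++ l l′ xs ys (suc-injective eq)))
        (sym (+-assoc mismatch (hamming l l′) (hamming xs ys)))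
  where
  mismatch : ℕ
  mismatch = if x ==S x′ then 0 else 1

hamming-refl : ∀ l → hamming l l ≡ 0
hamming-refl []      = refl
hamming-refl (x ∷ l) rewrite ==S-refl x = hamming-refl l

HammingOne-∷ʳ-distinct : ∀ l {x y} → x ≢ y → HammingOne (l ∷ʳ x) (l ∷ʳ y)
HammingOne-∷ʳ-distinct l {x} {y} x≢y =
  trans (length-++ l) (sym (length-++ l)) ,
  trans (hamming-++ l l [ x ] [ y ] refl) (cong₂ _+_ (hamming-refl l) last-differs)
  where
  last-differs : hamming [ x ] [ y ] ≡ 1
  last-differs rewrite ==S-≢ x≢y = refl

HammingOne-∷ʳ : ∀ {l l′} q → HammingOne l l′ → HammingOne (l ∷ʳ q) (l′ ∷ʳ q)
HammingOne-∷ʳ {l} {l′} q (same-length , one) =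
  trans (length-++ l) (trans (cong (_+ 1) same-length) (sym (length-++ l′))) ,
  trans (hamming-++ l l′ [ q ] [ q ] same-length) (cong₂ _+_ one (hamming-refl [ q ]))

Linked⇒ConsecutiveHammingOne : ∀ {L} → Linked HammingOne L → ConsecutiveHammingOne L
Linked⇒ConsecutiveHammingOne []       = _
Linked⇒ConsecutiveHammingOne [-]      = _
Linked⇒ConsecutiveHammingOne (h ∷ hs) = h , Linked⇒ConsecutiveHammingOne hs

module _ {X : Set} (x y : X) (A B C : List X) where
  open PermutationReasoning

  pivots-to-front : A ++ x ∷ B ++ y ∷ C ↭ x ∷ y ∷ A ++ B ++ C
  pivots-to-front = begin
    A ++ x ∷ B ++ y ∷ C  ↭⟨ ↭-shift x A (B ++ y ∷ C) ⟩
    x ∷ A ++ B ++ y ∷ C  ↭⟨ prep x (++⁺ˡ A (↭-shift y B C)) ⟩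
    x ∷ A ++ y ∷ B ++ C  ↭⟨ prep x (↭-shift y A (B ++ C)) ⟩
    x ∷ y ∷ A ++ B ++ C  ∎

  first-rotation : x ∷ reverse A ++ reverse C ++ reverse B ++ [ y ] ↭ x ∷ y ∷ A ++ B ++ C
  first-rotation = begin
    x ∷ reverse A ++ reverse C ++ reverse B ++ [ y ]
      ↭⟨ prep x (++⁺ˡ (reverse A) (++⁺ˡ (reverse C) (∷↭∷ʳ y (reverse B)))) ⟨
    x ∷ reverse A ++ reverse C ++ y ∷ reverse B
      ↭⟨ prep x (++⁺ˡ (reverse A) (↭-shift y (reverse C) (reverse B))) ⟩
    x ∷ reverse A ++ y ∷ reverse C ++ reverse B
      ↭⟨ prep x (↭-shift y (reverse A) (reverse C ++ reverse B)) ⟩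
    x ∷ y ∷ reverse A ++ reverse C ++ reverse B
      ↭⟨ prep x (prep y (++⁺ (↭-reverse A) (↭-trans (++-comm (reverse C) (reverse B))
                                                       (++⁺ (↭-reverse B) (↭-reverse C))))) ⟩
    x ∷ y ∷ A ++ B ++ C
      ∎

  second-rotation : y ∷ C ++ A ++ B ++ [ x ] ↭ x ∷ y ∷ A ++ B ++ C
  second-rotation = begin
    y ∷ C ++ A ++ B ++ [ x ]  ↭⟨ prep y (++⁺ˡ C (++⁺ˡ A (∷↭∷ʳ x B))) ⟨
    y ∷ C ++ A ++ x ∷ B       ↭⟨ prep y (++⁺ˡ C (↭-shift x A B)) ⟩
    y ∷ C ++ x ∷ A ++ B       ↭⟨ prep y (↭-shift x C (A ++ B)) ⟩
    y ∷ x ∷ C ++ A ++ B       ↭⟨ swap y x (↭-trans (++-comm C (A ++ B)) (++-assoc A B C)) ⟩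
    x ∷ y ∷ A ++ B ++ C       ∎

Unique-resp-↭ : ∀ {X : Set} {xs ys : List X} → xs ↭ ys → Unique xs → Unique ys
Unique-resp-↭ {X} p = Permutationₛ.Unique-resp-↭ (setoid X) (↭⇒↭ₛ p)

pivots-distinct : ∀ {X : Set} {x y : X} {A B C} → Unique (x ∷ y ∷ A ++ B ++ C) →
  x ≢ y × x ∉ A × y ∉ B
pivots-distinct {x = x} {y} {A} {B} {C} unique@(_ ∷ y-unique) =
  x∉ ∘ here , x∉ ∘ there ∘ ∈-++⁺ˡ , y∉ ∘ ∈-++⁺ʳ A ∘ ∈-++⁺ˡ
  where
  x∉ : x ∉ y ∷ A ++ B ++ C
  x∉ = Unique[x∷xs]⇒x∉xs unique
  y∉ : y ∉ A ++ B ++ C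
  y∉ = Unique[x∷xs]⇒x∉xs y-unique

module _ (Ω : Rule) {c₁ c₂ : Sym} where

  shift-at-c₁ : ∀ {k A B C} → syms Ω k ≡ A ++ c₁ ∷ B ++ c₂ ∷ C → c₁ ∉ A → c₂ ∉ B →
    shift Ω c₁ c₂ k c₁ ≡ just (c₁ ∷ reverse A ++ reverse C ++ reverse B ++ [ c₂ ])
  shift-at-c₁ {A = A} {B} {C} split c₁∉A c₂∉B
    rewrite split | splitOn-++ A (B ++ c₂ ∷ C) c₁∉A | splitOn-++ B C c₂∉B | ==S-refl c₁ = refl

  shift-at-c₂ : ∀ {k A B C} → syms Ω k ≡ A ++ c₁ ∷ B ++ c₂ ∷ C → c₁ ∉ A → c₂ ∉ B → c₁ ≢ c₂ →
    shift Ω c₁ c₂ k c₂ ≡ just (c₂ ∷ C ++ A ++ B ++ [ c₁ ])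
  shift-at-c₂ {A = A} {B} {C} split c₁∉A c₂∉B c₁≢c₂
    rewrite split | splitOn-++ A (B ++ c₂ ∷ C) c₁∉A | splitOn-++ B C c₂∉B
          | ==S-≢ (c₁≢c₂ ∘ sym) | ==S-refl c₂ = refl

module Generation (Ω : Rule) (c₁ c₂ : Sym)
  (splits : ∀ k → Reachable Ω k → ∃[ A ] ∃[ B ] ∃[ C ] (syms Ω k ≡ A ++ c₁ ∷ B ++ c₂ ∷ C)) where

  Pivot : Sym → Set
  Pivot p = p ≡ c₁ ⊎ p ≡ c₂

  ReachableSym : Sym → Set
  ReachableSym = Reachable Ω ∘ value

  rearranged-production : ∀ {k t} → Reachable Ω k → t ↭ syms Ω k →
    Linked _≢_ t × All ReachableSym t
  rearranged-production {k} rk t↭syms =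
    Linked.AllPairs⇒Linked (Unique-resp-↭ (↭-sym t↭syms) (annotate-unique [] _)) ,
    All-resp-↭ (↭-sym t↭syms) (All-annotate [] (toList (prod Ω k)) (All.tabulate (step rk)))

  record Shifted (k : ℕ) (p : Sym) : Set where
    field
      rest       : List Sym
      shift≡     : shift Ω c₁ c₂ k p ≡ just (p ∷ rest)
      next       : Sym
      lastM≡     : lastM (p ∷ rest) ≡ just next
      next-pivot : Pivot next
      distinct   : Linked _≢_ (p ∷ rest)
      reachable  : All ReachableSym (p ∷ rest)

  shifted : ∀ {k} → Reachable Ω k → ∀ {p} → Pivot p → Shifted k p
  shifted {k} rk p-pivot with splits k rk
  ... | A , B , C , split =
    at p-pivot (pivots-distinct (Unique-resp-↭ (↭-sym front↭syms) (annotate-unique [] _)))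
    where
    front↭syms : c₁ ∷ c₂ ∷ A ++ B ++ C ↭ syms Ω k
    front↭syms = subst (_ ↭_) (sym split) (↭-sym (pivots-to-front c₁ c₂ A B C))

    at : ∀ {p} → Pivot p → c₁ ≢ c₂ × c₁ ∉ A × c₂ ∉ B → Shifted k p
    at (inj₁ refl) (_ , c₁∉A , c₂∉B)
      with rearranged-production rk (↭-trans (first-rotation c₁ c₂ A B C) front↭syms)
    ... | distinct , reachable = record
      { rest       = reverse A ++ reverse C ++ reverse B ++ [ c₂ ]
      ; shift≡     = shift-at-c₁ Ω split c₁∉A c₂∉B
      ; next       = c₂
      ; lastM≡     = lastM-++ (c₁ ∷ reverse A) (lastM-++ (reverse C) (lastM-++ (reverse B) refl))
      ; next-pivot = inj₂ refl
      ; distinct   = distinct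
      ; reachable  = reachable
      }
    at (inj₂ refl) (c₁≢c₂ , c₁∉A , c₂∉B)
      with rearranged-production rk (↭-trans (second-rotation c₁ c₂ A B C) front↭syms)
    ... | distinct , reachable = record
      { rest       = C ++ A ++ B ++ [ c₁ ]
      ; shift≡     = shift-at-c₂ Ω split c₁∉A c₂∉B c₁≢c₂
      ; next       = c₁
      ; lastM≡     = lastM-++ (c₂ ∷ C) (lastM-++ A (lastM-++ B refl))
      ; next-pivot = inj₁ refl
      ; distinct   = distinct
      ; reachable  = reachable
      }

  ReachableEnd : Word → Set
  ReachableEnd w = ∃[ r ] (lastM w ≡ just r × ReachableSym r)

  block-ends : ∀ l {t} → All ReachableSym t → All ReachableEnd (map (l ∷ʳ_) t)
  block-ends l []       = []
  block-ends l (r ∷ rs) = (_ , lastM-++ l refl , r) ∷ block-ends l rs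

  block-linked : ∀ l {t} → Linked _≢_ t → Linked HammingOne (map (l ∷ʳ_) t)
  block-linked l = Linked.map⁺ ∘ Linked.map (HammingOne-∷ʳ-distinct l)

  Connected-∷ʳ : ∀ {l m} q → Connected HammingOne (just l) m →
    Connected HammingOne (just (l ∷ʳ q)) (Maybe.map (_∷ʳ q) m)
  Connected-∷ʳ {l} {just l′} q (just h) = just (HammingOne-∷ʳ {l} {l′} q h)
  Connected-∷ʳ q just-nothing = just-nothing

  nextGo-linked : ∀ {p} → Pivot p → ∀ {ws} → All ReachableEnd ws → Linked HammingOne ws →
    ∃[ L ] (nextGo Ω c₁ c₂ p ws ≡ just L × All ReachableEnd L × Linked HammingOne L
            × head L ≡ Maybe.map (_∷ʳ p) (head ws))
  nextGo-linked _ [] _ = [] , refl , [] , [] , refl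
  nextGo-linked {p} p-pivot {l ∷ ws} ((r , lastM≡r , reachable-r) ∷ ends) linked
    with shifted reachable-r p-pivot
  ... | record { rest = rest ; shift≡ = shift≡ ; next = q ; lastM≡ = lastM≡q
               ; next-pivot = q-pivot ; distinct = distinct ; reachable = reachable }
    with nextGo-linked q-pivot ends (Linked.tail linked)
  ... | L , nextGo≡ , ends′ , linked′ , head≡ =
    map (l ∷ʳ_) (p ∷ rest) ++ L , unfold , All.++⁺ (block-ends l reachable) ends′ ,
    Linked.++⁺ (block-linked l distinct) joint linked′ , refl
    where
    unfold : nextGo Ω c₁ c₂ p (l ∷ ws) ≡ just (map (l ∷ʳ_) (p ∷ rest) ++ L)
    unfold rewrite lastM≡r | shift≡ | lastM≡q | nextGo≡ = refl

    last-block : last (map (l ∷ʳ_) (p ∷ rest)) ≡ just (l ∷ʳ q)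
    last-block = trans (last-map _ (p ∷ rest))
                       (cong (Maybe.map _) (trans (sym (lastM≗last (p ∷ rest))) lastM≡q))

    joint : Connected HammingOne (last (map (l ∷ʳ_) (p ∷ rest))) (head L)
    joint = subst₂ (Connected HammingOne) (sym last-block) (sym head≡)
                   (Connected-∷ʳ q (Linked.head′ linked))

  𝓛-linked : ∀ n → ∃[ L ] (𝓛 Ω c₁ c₂ (suc n) ≡ just L × All ReachableEnd L × Linked HammingOne L)
  𝓛-linked zero = [ [ axiomSym Ω ] ] , refl , (axiomSym Ω , refl , ax) ∷ [] , [-]
  𝓛-linked (suc n) with 𝓛-linked n
  ... | L , 𝓛≡ , ends , linked with nextGo-linked (inj₁ refl) ends linked
  ... | L′ , nextGo≡ , ends′ , linked′ , _ =
    L′ , trans (cong (_>>= nextGo Ω c₁ c₂ c₁) 𝓛≡) nextGo≡ , ends′ , linked′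

proposition2 : (Ω : Rule) (c₁ c₂ : Sym) → Stable Ω c₁ c₂ →
    (n : ℕ) → 1 ≤ n →
    ∃[ L ] (𝓛 Ω c₁ c₂ n ≡ just L × ConsecutiveHammingOne L)
proposition2 Ω c₁ c₂ (_ , splits) (suc n) _ with Generation.𝓛-linked Ω c₁ c₂ splits n
... | L , 𝓛≡ , _ , linked = L , 𝓛≡ , Linked⇒ConsecutiveHammingOne linked
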